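{- For all integers $n\ge 0$ and $m>k\ge 0$, \[ \sum_{\ell=0}^{m}(-1)^\ell\genfrac{[}{]}{0pt}{}{m+1}{\ell+1}C_{n+\ell}^k(x)=0. \]
   Context: $\genfrac{[}{]}{0pt}{}{m}{j}$ denotes the unsigned Stirling numbers of the first kind. Callan polynomials: for $n,k\ge0$ let $N=\{1,\dots,n\}\cup\{*\}$, $K=\{1,\dots,k\}\cup\{*'\}$. A Callan sequence of size $n\times k$ consists of $r\ge0$, a set partition of $N$ into nonempty blocks $R_1,\dots,R_r,R^*$ with $*\in R^*$ and of $K$ into nonempty blocks $B_1,\dots,B_r,B^*$ with $*'\in B^*$, arranged as the ordered list of ordinary pairs $(B_1;R_1)\cdots(B_r;R_r)$ (order matters) plus the extra pair $(B^*;R^*)$. A barred Callan sequence additionally has one bar in one of the $r+1$ gaps before, between, or after the ordinary pairs; $\mathrm{BC}_n^k$ is their set. For a word of distinct letters from a totally ordered set let $w$ be its number of left-to-right minima minus one. For $\alpha\in\mathrm{BC}_n^k$, list from left to right the blue blocks $B_1,\dots,B_r$ and the bar as they appear (extra pair ignored), with the bar smaller than every blue block and blue blocks compared by least elements; $w(\alpha)$ is $w$ of this word. $C_n^k(x)=\sum_{\alpha\in\mathrm{BC}_n^k}x^{w(\alpha)}$ for $n,k>0$, and $C_n^0(x)=C_0^k(x)=1$. -}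

module Defs where

open import Data.Nat using (ℕ; zero; suc; _+_; _*_; _∸_; _<ᵇ_; _≡ᵇ_)
open import Data.Bool using (Bool; true; false; if_then_else_; _∧_; _∨_)
open import Data.Fin as Fin using (Fin; toℕ)
open import Data.Vec using (Vec; []; _∷_; toList)
open import Data.List using (List; []; _∷_; [_]; map; concatMap; filter; length; upTo; allFin; take; drop; _++_; foldr)
open import Data.Bool.ListAction using (all; any)
open import Data.Bool.Properties using () renaming (_≟_ to _≟B_)
open import Data.Integer as ℤ using (ℤ)
open import Relation.Nullary.Decidable using (⌊_⌋)
open import Data.Product using (Σ; _,_)

stirling1 : ℕ → ℕ → ℕ
stirling1 zero    zero    = 1
stirling1 zero    (suc j) = 0
stirling1 (suc m) zero    = 0
stirling1 (suc m) (suc j) = m * stirling1 m (suc j) + stirling1 m j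

allVecs : {A : Set} → (n : ℕ) → List A → List (Vec A n)
allVecs zero    xs = [ [] ]
allVecs (suc n) xs = concatMap (λ x → map (x ∷_) (allVecs n xs)) xs

-- A (candidate) barred Callan sequence of size n × k with r ordinary pairs.
-- red  : colour assignment of the red elements 1..n  (Fin.zero = the extra
--        block R^*, suc i = ordinary red block R_{i+1});
-- blue : the same for the blue elements 1..k  (Fin.zero = B^*, suc i = B_{i+1});
-- bar  : the gap containing the bar (0 = before the first ordinary pair,
--        r = after the last one).
-- The i-th ordinary pair is (B_i ; R_i); the extra pair is (B^* ∪ {*'} ; R^* ∪ {*}).
record BarredCallan (n k : ℕ) : Set where
  constructor mkBC
  field
    r    : ℕ
    red  : Vec (Fin (suc r)) n
    blue : Vec (Fin (suc r)) k
    bar  : Fin (suc r)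

occurs : {r : ℕ} → Fin (suc r) → List (Fin (suc r)) → Bool
occurs c = any (λ y → ⌊ y Fin.≟ c ⌋)

ordinaryNonempty : {r m : ℕ} → Vec (Fin (suc r)) m → Bool
ordinaryNonempty {r} v = all (λ i → occurs (Fin.suc i) (toList v)) (allFin r)

validBC : {n k : ℕ} → BarredCallan n k → Bool
validBC (mkBC r red blue bar) = ordinaryNonempty red ∧ ordinaryNonempty blue

-- All barred Callan sequences of size n × k (r ≤ n necessarily, since the
-- r ordinary red blocks are nonempty and disjoint subsets of {1..n}).
allBC : (n k : ℕ) → List (BarredCallan n k)
allBC n k = filter (λ α → validBC α ≟B true)
  (concatMap (λ r →
     concatMap (λ red →
       concatMap (λ blue →
         map (λ b → mkBC r red blue b) (allFin (suc r)))
       (allVecs k (allFin (suc r))))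
     (allVecs n (allFin (suc r))))
   (upTo (suc n)))

-- Position (0-based) of the first occurrence of c in a list (length if absent).
firstPos : {r : ℕ} → Fin (suc r) → List (Fin (suc r)) → ℕ
firstPos c []       = 0
firstPos c (y ∷ ys) = if ⌊ y Fin.≟ c ⌋ then 0 else suc (firstPos c ys)

ltrMinFrom : ℕ → List ℕ → ℕ
ltrMinFrom m []       = 0
ltrMinFrom m (x ∷ xs) = if x <ᵇ m then suc (ltrMinFrom x xs) else ltrMinFrom m xs

ltrMin : List ℕ → ℕ
ltrMin []       = 0
ltrMin (x ∷ xs) = suc (ltrMinFrom x xs)

-- The bar is encoded as the letter 0,
-- the blue block B_i as 1 + (least element of B_i, 0-based), so the bar is
-- smaller than every blue block and blue blocks are compared by least elements.
bcWord : {n k : ℕ} → BarredCallan n k → List ℕ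
bcWord (mkBC r red blue bar) =
  take (toℕ bar) letters ++ 0 ∷ drop (toℕ bar) letters
  where
    letters : List ℕ
    letters = map (λ i → suc (firstPos (Fin.suc i) (toList blue))) (allFin r)

wStat : {n k : ℕ} → BarredCallan n k → ℕ
wStat α = ltrMin (bcWord α) ∸ 1

callanCoeff : ℕ → ℕ → ℕ → ℕ
callanCoeff zero    k       j = if j ≡ᵇ 0 then 1 else 0
callanCoeff (suc n) zero    j = if j ≡ᵇ 0 then 1 else 0
callanCoeff (suc n) (suc k) j =
  length (filter (λ α → wStat α ≟ j) (allBC (suc n) (suc k)))
  where open import Data.Nat using (_≟_)

sumTo : ℕ → (ℕ → ℤ) → ℤ
sumTo m f = foldr (λ l acc → f l ℤ.+ acc) (ℤ.+ 0) (upTo (suc m))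

signZ : ℕ → ℤ
signZ zero    = ℤ.+ 1
signZ (suc l) = ℤ.- signZ l

stirlingCallanSumCoeff : ℕ → ℕ → ℕ → ℕ → ℤ
stirlingCallanSumCoeff n k m j =
  sumTo m (λ l → signZ l ℤ.* (ℤ.+ stirling1 (suc m) (suc l)) ℤ.* ℤ.+ callanCoeff (n + l) k j)

module Submission where

open import Defs
open import Data.Nat using (ℕ; _<_)
open import Data.Integer using (ℤ; +_)
open import Relation.Binary.PropositionalEquality using (_≡_)

-- Let E be the shift  (E f) n = f (n+1)  on integer sequences.
-- (1) The Stirling sum  f ↦ Σ_l (-1)^l [m+1, l+1] f(n+l)  is the operator
--     (m − E)(m−1 − E) ⋯ (1 − E), by the recurrence of the Stirling numbers.
-- (2) Splitting barred Callan sequences by their number r of ordinary pairs,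
--     [x^j] C_n^k = Σ_{r ≤ k} b(k,r,j) · ρ(n,r): the red colouring (counted by
--     ρ, which uses all of the colours 1..r out of 0..r) is independent of the
--     blue colouring and bar (counted by b), and w only depends on the latter.
-- (3) n ↦ ρ(n,r) is killed by (r+1 − E) ⋯ (1 − E): words required to contain s
--     given letters are killed by (r+1 − E) ⋯ (r+1−s − E), by induction on s
--     using the decomposition of a word by its first letter.
-- As r ≤ k < m, all factors of (3) occur in (1), and linearity concludes.

module IntegerSums where
  open import Data.Nat as ℕ using (zero; suc; _≤_; z≤n; s≤s)
  import Data.Nat.Properties as ℕP
  open import Data.Integer using (_+_; _*_; -_)
  import Data.Integer.Properties as ℤP
  open import Data.List using (List; foldr; upTo; applyUpTo)
  open import Data.Integer.Tactic.RingSolver using (solve-∀)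
  open import Relation.Binary.PropositionalEquality

  -- Σ_{x ∈ xs} f x.  As a right fold, 'sumTo m f' of Defs is literally
  -- 'sumL (upTo (suc m)) f'.
  sumL : {A : Set} → List A → (A → ℤ) → ℤ
  sumL xs f = foldr (λ x acc → f x + acc) (+ 0) xs

  S : ℕ → (ℕ → ℤ) → ℤ
  S zero    f = + 0
  S (suc a) f = f 0 + S a (λ l → f (suc l))

  sumL-applyUpTo : ∀ (f : ℕ → ℤ) g a → sumL (applyUpTo g a) f ≡ S a (λ l → f (g l))
  sumL-applyUpTo f g zero    = refl
  sumL-applyUpTo f g (suc a) = cong (_+_ (f (g 0))) (sumL-applyUpTo f (λ l → g (suc l)) a)

  sumL-upTo : ∀ a f → sumL (upTo a) f ≡ S a f
  sumL-upTo a f = sumL-applyUpTo f (λ l → l) a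

  S-cong : ∀ a {f g : ℕ → ℤ} → (∀ l → l < a → f l ≡ g l) → S a f ≡ S a g
  S-cong zero    e = refl
  S-cong (suc a) e = cong₂ _+_ (e 0 (s≤s z≤n)) (S-cong a (λ l l<a → e (suc l) (s≤s l<a)))

  S-vanish : ∀ a {f : ℕ → ℤ} → (∀ l → l < a → f l ≡ + 0) → S a f ≡ + 0
  S-vanish zero    z = refl
  S-vanish (suc a) z = cong₂ _+_ (z 0 (s≤s z≤n)) (S-vanish a (λ l l<a → z (suc l) (s≤s l<a)))

  S-snoc : ∀ a f → S (suc a) f ≡ S a f + f a
  S-snoc zero    f = ℤP.+-comm (f 0) (+ 0)
  S-snoc (suc a) f = begin
    f 0 + S (suc a) (λ l → f (suc l))         ≡⟨ cong (_+_ (f 0)) (S-snoc a (λ l → f (suc l))) ⟩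
    f 0 + (S a (λ l → f (suc l)) + f (suc a)) ≡⟨ ℤP.+-assoc (f 0) _ _ ⟨
    S (suc a) f + f (suc a)                   ∎
    where open ≡-Reasoning

  S-add : ∀ a f g → S a (λ l → f l + g l) ≡ S a f + S a g
  S-add zero    f g = refl
  S-add (suc a) f g =
    trans (cong (_+_ (f 0 + g 0)) (S-add a (λ l → f (suc l)) (λ l → g (suc l))))
          (interchange (f 0) (g 0) _ _)
    where
    interchange : ∀ x y X Y → x + y + (X + Y) ≡ x + X + (y + Y)
    interchange = solve-∀

  S-scale : ∀ a c f → S a (λ l → c * f l) ≡ c * S a f
  S-scale zero    c f = sym (ℤP.*-zeroʳ c)
  S-scale (suc a) c f = trans (cong (_+_ (c * f 0)) (S-scale a c (λ l → f (suc l))))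
                              (sym (ℤP.*-distribˡ-+ c (f 0) _))

  S-neg : ∀ a f → S a (λ l → - f l) ≡ - S a f
  S-neg zero    f = refl
  S-neg (suc a) f = trans (cong (_+_ (- f 0)) (S-neg a (λ l → f (suc l))))
                          (sym (ℤP.neg-distrib-+ (f 0) _))

  S-extend : ∀ a f → (∀ l → a ≤ l → f l ≡ + 0) → ∀ d → S (a ℕ.+ d) f ≡ S a f
  S-extend a f z zero    = cong (λ b → S b f) (ℕP.+-identityʳ a)
  S-extend a f z (suc d) = begin
    S (a ℕ.+ suc d) f           ≡⟨ cong (λ b → S b f) (ℕP.+-suc a d) ⟩
    S (suc (a ℕ.+ d)) f         ≡⟨ S-snoc (a ℕ.+ d) f ⟩
    S (a ℕ.+ d) f + f (a ℕ.+ d) ≡⟨ cong₂ _+_ (S-extend a f z d) (z _ (ℕP.m≤m+n a d)) ⟩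
    S a f + + 0                 ≡⟨ ℤP.+-identityʳ (S a f) ⟩
    S a f                       ∎
    where open ≡-Reasoning

  S-stable : ∀ a b f → (∀ l → a ≤ l → f l ≡ + 0) → (∀ l → b ≤ l → f l ≡ + 0) → S a f ≡ S b f
  S-stable a b f za zb = begin
    S a f         ≡⟨ S-extend a f za b ⟨
    S (a ℕ.+ b) f ≡⟨ cong (λ c → S c f) (ℕP.+-comm a b) ⟩
    S (b ℕ.+ a) f ≡⟨ S-extend b f zb a ⟩
    S b f         ∎
    where open ≡-Reasoning

-- The difference operators  c − E  on integer sequences, E being the shift.
-- Composites of such operators are linear and shift-invariant, hence commute
-- with one another; that is all the algebra the proof needs.
module DifferenceOperators where
  open import Data.Nat using (zero; suc)
  open import Data.Integer using (_+_; _*_; _-_; -_)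
  open import Data.Integer.Tactic.RingSolver using (solve-∀)
  open import Data.List using (List; []; _∷_; _++_; [_])
  open import Relation.Binary.PropositionalEquality hiding ([_])
  open IntegerSums

  Seq : Set
  Seq = ℕ → ℤ

  diff : ℤ → Seq → Seq
  diff c f n = c * f n - f (suc n)

  diffs : List ℤ → Seq → Seq
  diffs []      f = f
  diffs (c ∷ L) f = diff c (diffs L f)

  Annihilates : List ℤ → Seq → Set
  Annihilates L f = ∀ n → diffs L f n ≡ + 0

  diffs-cong : ∀ L {f g : Seq} → (∀ n → f n ≡ g n) → ∀ n → diffs L f n ≡ diffs L g n
  diffs-cong []      e n = e n
  diffs-cong (c ∷ L) e n = cong₂ (λ x y → c * x - y) (diffs-cong L e n) (diffs-cong L e (suc n))

  diffs-shift : ∀ L (f : Seq) n → diffs L (λ m → f (suc m)) n ≡ diffs L f (suc n)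
  diffs-shift []      f n = refl
  diffs-shift (c ∷ L) f n = cong₂ (λ x y → c * x - y) (diffs-shift L f n) (diffs-shift L f (suc n))

  diffs-linear : ∀ L a b (f g : Seq) n →
                 diffs L (λ m → a * f m + b * g m) n ≡ a * diffs L f n + b * diffs L g n
  diffs-linear []      a b f g n = refl
  diffs-linear (c ∷ L) a b f g n =
    trans (cong₂ (λ x y → c * x - y) (diffs-linear L a b f g n) (diffs-linear L a b f g (suc n)))
          (distribute c a b _ _ _ _)
    where
    distribute : ∀ c a b F G F′ G′ →
                 c * (a * F + b * G) - (a * F′ + b * G′) ≡ a * (c * F - F′) + b * (c * G - G′)
    distribute = solve-∀

  diff-zero : ∀ c → c * + 0 - + 0 ≡ + 0
  diff-zero = solve-∀

  annihilates-cons : ∀ L c f → Annihilates L f → Annihilates (c ∷ L) f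
  annihilates-cons L c f killed n =
    trans (cong₂ (λ x y → c * x - y) (killed n) (killed (suc n))) (diff-zero c)

  diffs-zero : ∀ L → Annihilates L (λ _ → + 0)
  diffs-zero []      n = refl
  diffs-zero (c ∷ L) = annihilates-cons L c (λ _ → + 0) (diffs-zero L)

  diffs-scale : ∀ L a (f : Seq) n → diffs L (λ m → a * f m) n ≡ a * diffs L f n
  diffs-scale L a f n =
    trans (diffs-cong L (λ m → sym (drop₂ a (f m) (f m))) n)
          (trans (diffs-linear L a (+ 0) f f n) (drop₂ a (diffs L f n) (diffs L f n)))
    where
    drop₂ : ∀ a F G → a * F + + 0 * G ≡ a * F
    drop₂ = solve-∀

  diffs-add : ∀ L (f g : Seq) n → diffs L (λ m → f m + g m) n ≡ diffs L f n + diffs L g n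
  diffs-add L f g n =
    trans (diffs-cong L (λ m → sym (unit (f m) (g m))) n)
          (trans (diffs-linear L (+ 1) (+ 1) f g n) (unit (diffs L f n) (diffs L g n)))
    where
    unit : ∀ X Y → + 1 * X + + 1 * Y ≡ X + Y
    unit = solve-∀

  diffs-sumL : ∀ {A : Set} L (xs : List A) (g : A → Seq) n →
               diffs L (λ m → sumL xs (λ x → g x m)) n ≡ sumL xs (λ x → diffs L (g x) n)
  diffs-sumL L []       g n = diffs-zero L n
  diffs-sumL L (x ∷ xs) g n =
    trans (diffs-add L (g x) (λ m → sumL xs (λ y → g y m)) n)
          (cong (_+_ (diffs L (g x) n)) (diffs-sumL L xs g n))

  diffs-S : ∀ L a (g : ℕ → Seq) n →
            diffs L (λ m → S a (λ r → g r m)) n ≡ S a (λ r → diffs L (g r) n)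
  diffs-S L zero    g n = diffs-zero L n
  diffs-S L (suc a) g n =
    trans (diffs-add L (g 0) (λ m → S a (λ r → g (suc r) m)) n)
          (cong (_+_ (diffs L (g 0) n)) (diffs-S L a (λ r → g (suc r)) n))

  -- Every composite commutes with  c − E  (linearity plus shift-invariance).
  diffs-commute : ∀ L c (f : Seq) n → diffs L (diff c f) n ≡ diff c (diffs L f) n
  diffs-commute L c f n = begin
    diffs L (diff c f) n
      ≡⟨ diffs-cong L (λ m → sym (asCombination c (f m) (f (suc m)))) n ⟩
    diffs L (λ m → c * f m + (- + 1) * f (suc m)) n
      ≡⟨ diffs-linear L c (- + 1) f (λ m → f (suc m)) n ⟩
    c * diffs L f n + (- + 1) * diffs L (λ m → f (suc m)) n
      ≡⟨ cong (λ z → c * diffs L f n + (- + 1) * z) (diffs-shift L f n) ⟩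
    c * diffs L f n + (- + 1) * diffs L f (suc n)
      ≡⟨ asCombination c (diffs L f n) (diffs L f (suc n)) ⟩
    diff c (diffs L f) n ∎
    where
    open ≡-Reasoning
    asCombination : ∀ c F G → c * F + (- + 1) * G ≡ c * F - G
    asCombination = solve-∀

  diffs-snoc : ∀ L c (f : Seq) n → diffs (L ++ [ c ]) f n ≡ diff c (diffs L f) n
  diffs-snoc L c f n = trans (innermost L n) (diffs-commute L c f n)
    where
    innermost : ∀ L n → diffs (L ++ [ c ]) f n ≡ diffs L (diff c f) n
    innermost []      n = refl
    innermost (d ∷ L) n = cong₂ (λ x y → d * x - y) (innermost L n) (innermost L (suc n))

module StirlingOperator where
  open import Data.Nat as ℕ using (zero; suc; pred)
  import Data.Nat.Properties as ℕP
  open import Data.Integer using (_+_; _*_; _-_; -_)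
  import Data.Integer.Properties as ℤP
  open import Data.Integer.Tactic.RingSolver using (solve-∀)
  open import Data.List using (List; []; _∷_)
  open import Relation.Binary.PropositionalEquality
  open IntegerSums
  open DifferenceOperators

  stirling1-vanish : ∀ a b → a < b → stirling1 a b ≡ 0
  stirling1-vanish zero    (suc b) _ = refl
  stirling1-vanish (suc a) (suc b) (ℕ.s≤s a<b)
    rewrite stirling1-vanish a (suc b) (ℕP.m<n⇒m<1+n a<b) | stirling1-vanish a b a<b =
    trans (ℕP.+-identityʳ (a ℕ.* 0)) (ℕP.*-zeroʳ a)

  stirlingOp : ℕ → Seq → Seq
  stirlingOp m f n = S (suc m) (λ l → signZ l * + stirling1 (suc m) (suc l) * f (n ℕ.+ l))

  sumTo≡stirlingOp : ∀ m f n →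
    sumTo m (λ l → signZ l * + stirling1 (suc m) (suc l) * f (n ℕ.+ l)) ≡ stirlingOp m f n
  sumTo≡stirlingOp m f n = sumL-upTo (suc m) (λ l → signZ l * + stirling1 (suc m) (suc l) * f (n ℕ.+ l))

  fallingFrom : ℕ → ℕ → List ℤ
  fallingFrom t zero    = []
  fallingFrom t (suc s) = + t ∷ fallingFrom (pred t) s

  falling : ℕ → List ℤ
  falling m = fallingFrom m m

  -- The Stirling recurrence [m+2, l+1] = (m+1)[m+1, l+1] + [m+1, l] makes
  -- the operator for m+1 equal to (m+1 − E) applied to the one for m.
  stirlingOp-suc : ∀ m f n → stirlingOp (suc m) f n ≡ diff (+ suc m) (stirlingOp m f) n
  stirlingOp-suc m f n = begin
    stirlingOp (suc m) f n
      ≡⟨ S-cong (suc (suc m)) (λ l _ → recurrence l) ⟩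
    S (suc (suc m)) (λ l → M * t l + u l)
      ≡⟨ S-add (suc (suc m)) (λ l → M * t l) u ⟩
    S (suc (suc m)) (λ l → M * t l) + S (suc (suc m)) u
      ≡⟨ cong (_+ S (suc (suc m)) u) (S-scale (suc (suc m)) M t) ⟩
    M * S (suc (suc m)) t + S (suc (suc m)) u
      ≡⟨ cong₂ (λ x y → M * x + y) lastTermVanishes firstTermVanishes ⟩
    M * (stirlingOp m f n + + 0) + (+ 0 + - stirlingOp m f (suc n))
      ≡⟨ tidy M (stirlingOp m f n) (stirlingOp m f (suc n)) ⟩
    diff M (stirlingOp m f) n ∎
    where
    open ≡-Reasoning
    M = + suc m
    t u : ℕ → ℤ
    t l = signZ l * + stirling1 (suc m) (suc l) * f (n ℕ.+ l)
    u l = signZ l * + stirling1 (suc m) l * f (n ℕ.+ l)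

    expand : ∀ σ M s₁ s₂ F → σ * (M * s₁ + s₂) * F ≡ M * (σ * s₁ * F) + σ * s₂ * F
    expand = solve-∀
    annihilate : ∀ σ F → σ * + 0 * F ≡ + 0
    annihilate = solve-∀
    negate : ∀ σ s F → (- σ) * s * F ≡ - (σ * s * F)
    negate = solve-∀
    tidy : ∀ M X Y → M * (X + + 0) + (+ 0 + - Y) ≡ M * X - Y
    tidy = solve-∀

    recurrence : ∀ l → signZ l * + stirling1 (suc (suc m)) (suc l) * f (n ℕ.+ l) ≡ M * t l + u l
    recurrence l = begin
      signZ l * + (suc m ℕ.* stirling1 (suc m) (suc l) ℕ.+ stirling1 (suc m) l) * f (n ℕ.+ l)
        ≡⟨ cong (λ z → signZ l * z * f (n ℕ.+ l))
                (trans (ℤP.pos-+ (suc m ℕ.* stirling1 (suc m) (suc l)) _)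
                       (cong (_+ + stirling1 (suc m) l) (ℤP.pos-* (suc m) _))) ⟩
      signZ l * (M * + stirling1 (suc m) (suc l) + + stirling1 (suc m) l) * f (n ℕ.+ l)
        ≡⟨ expand (signZ l) M _ _ _ ⟩
      M * t l + u l ∎

    -- [m+1, m+2] = 0 kills the new last term of the first sum ...
    lastTermVanishes : S (suc (suc m)) t ≡ stirlingOp m f n + + 0
    lastTermVanishes = trans (S-snoc (suc m) t) (cong (_+_ (stirlingOp m f n)) lastTerm)
      where
      lastTerm : t (suc m) ≡ + 0
      lastTerm rewrite stirling1-vanish (suc m) (suc (suc m)) (ℕP.n<1+n (suc m)) =
        annihilate (signZ (suc m)) _

    -- ... and [m+1, 0] = 0 the first term of the second, which is then a shifted copy.
    firstTermVanishes : S (suc (suc m)) u ≡ + 0 + - stirlingOp m f (suc n)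
    firstTermVanishes = cong₂ _+_ (annihilate (+ 1) (f (n ℕ.+ 0)))
      (trans (S-cong (suc m) (λ l _ →
                trans (cong (λ z → - signZ l * + stirling1 (suc m) (suc l) * f z) (ℕP.+-suc n l))
                      (negate (signZ l) _ _)))
             (S-neg (suc m) (λ l → signZ l * + stirling1 (suc m) (suc l) * f (suc n ℕ.+ l))))

  stirlingOp≡diffs : ∀ m f n → stirlingOp m f n ≡ diffs (falling m) f n
  stirlingOp≡diffs zero    f n =
    trans (ℤP.+-identityʳ _) (trans (ℤP.*-identityˡ (f (n ℕ.+ 0))) (cong f (ℕP.+-identityʳ n)))
  stirlingOp≡diffs (suc m) f n =
    trans (stirlingOp-suc m f n)
          (cong₂ (λ x y → + suc m * x - y) (stirlingOp≡diffs m f n) (stirlingOp≡diffs m f (suc n)))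

module Counting where
  open import Data.Nat using (suc; _+_; _*_)
  open import Data.Nat.Properties using (+-suc)
  open import Data.Bool using (Bool; true; false; if_then_else_; _∧_; _∨_; not)
  open import Data.List using (List; []; _∷_; _++_; map; concatMap; foldr; length; filter)
  open import Relation.Nullary.Decidable using (does)
  open import Relation.Unary using (Pred; Decidable)
  open import Level using (0ℓ)
  open import Relation.Binary.PropositionalEquality
  import Data.Integer as ℤ
  import Data.Integer.Properties as ℤP
  open IntegerSums using (sumL)

  count : {A : Set} → (A → Bool) → List A → ℕ
  count p []       = 0
  count p (x ∷ xs) = if p x then suc (count p xs) else count p xs

  sumN : {A : Set} → List A → (A → ℕ) → ℕ
  sumN xs f = foldr (λ x acc → f x + acc) 0 xs

  count-cong : {A : Set} {p q : A → Bool} → (∀ x → p x ≡ q x) → ∀ xs → count p xs ≡ count q xs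
  count-cong e []                  = refl
  count-cong {q = q} e (x ∷ xs) rewrite e x = cong (λ c → if q x then suc c else c) (count-cong e xs)

  sumN-cong : {A : Set} {f g : A → ℕ} → (∀ x → f x ≡ g x) → ∀ xs → sumN xs f ≡ sumN xs g
  sumN-cong e []       = refl
  sumN-cong e (x ∷ xs) = cong₂ _+_ (e x) (sumN-cong e xs)

  count-false : {A : Set} (xs : List A) → count (λ _ → false) xs ≡ 0
  count-false []       = refl
  count-false (x ∷ xs) = count-false xs

  sumN-vanish : {A : Set} {f : A → ℕ} (xs : List A) → (∀ x → f x ≡ 0) → sumN xs f ≡ 0
  sumN-vanish []       z = refl
  sumN-vanish (x ∷ xs) z = cong₂ _+_ (z x) (sumN-vanish xs z)

  count-++ : {A : Set} (p : A → Bool) (xs ys : List A) → count p (xs ++ ys) ≡ count p xs + count p ys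
  count-++ p []       ys = refl
  count-++ p (x ∷ xs) ys with p x
  ... | true  = cong suc (count-++ p xs ys)
  ... | false = count-++ p xs ys

  count-concatMap : {A B : Set} (p : B → Bool) (h : A → List B) (xs : List A) →
                    count p (concatMap h xs) ≡ sumN xs (λ x → count p (h x))
  count-concatMap p h []       = refl
  count-concatMap p h (x ∷ xs) =
    trans (count-++ p (h x) (concatMap h xs)) (cong (_+_ (count p (h x))) (count-concatMap p h xs))

  count-map : {A B : Set} (p : B → Bool) (f : A → B) (xs : List A) →
              count p (map f xs) ≡ count (λ x → p (f x)) xs
  count-map p f []       = refl
  count-map p f (x ∷ xs) with p (f x)
  ... | true  = cong suc (count-map p f xs)
  ... | false = count-map p f xs

  count-filter : {A : Set} {P : Pred A 0ℓ} (P? : Decidable P) (q : A → Bool) (xs : List A) →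
                 count q (filter P? xs) ≡ count (λ x → does (P? x) ∧ q x) xs
  count-filter P? q []       = refl
  count-filter P? q (x ∷ xs) with does (P? x)
  ... | false = count-filter P? q xs
  ... | true with q x
  ...   | true  = cong suc (count-filter P? q xs)
  ...   | false = count-filter P? q xs

  length-filter : {A : Set} {P : Pred A 0ℓ} (P? : Decidable P) (xs : List A) →
                  length (filter P? xs) ≡ count (λ x → does (P? x)) xs
  length-filter P? []       = refl
  length-filter P? (x ∷ xs) with does (P? x)
  ... | true  = cong suc (length-filter P? xs)
  ... | false = length-filter P? xs

  sumN-indicator : {A : Set} (p : A → Bool) (c : ℕ) (xs : List A) →
                   sumN xs (λ x → if p x then c else 0) ≡ count p xs * c
  sumN-indicator p c []       = refl
  sumN-indicator p c (x ∷ xs) with p x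
  ... | true  = cong (_+_ c) (sumN-indicator p c xs)
  ... | false = sumN-indicator p c xs

  count-not : {A : Set} (p : A → Bool) (xs : List A) → count (λ x → not (p x)) xs + count p xs ≡ length xs
  count-not p []       = refl
  count-not p (x ∷ xs) with p x
  ... | true  = trans (+-suc _ _) (cong suc (count-not p xs))
  ... | false = cong suc (count-not p xs)

  count-∨ : {A : Set} (p q : A → Bool) → (∀ x → p x ≡ true → q x ≡ false) → ∀ xs →
            count (λ x → p x ∨ q x) xs ≡ count p xs + count q xs
  count-∨ p q exclusive []       = refl
  count-∨ p q exclusive (x ∷ xs) with p x in px
  ... | true rewrite exclusive x px = cong suc (count-∨ p q exclusive xs)
  ... | false with q x
  ...   | true  = trans (cong suc (count-∨ p q exclusive xs)) (sym (+-suc _ _))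
  ...   | false = count-∨ p q exclusive xs

  pos-sumN : {A : Set} (xs : List A) (f : A → ℕ) → + sumN xs f ≡ sumL xs (λ x → + f x)
  pos-sumN []       f = refl
  pos-sumN (x ∷ xs) f = trans (ℤP.pos-+ (f x) _)
                              (cong (ℤ._+_ (+ f x)) (pos-sumN xs f))

-- Words over the alphabet Fin (suc r) containing every letter of a list of
-- required letters.  A red (or blue) colouring of a Callan sequence with r
-- ordinary pairs is such a word, the required letters being 1, …, r.
module CoveringWords where
  open import Data.Nat using (zero; suc; _+_; _∸_; _≤_)
  open import Data.Nat.Properties using (≤-pred; <-trans; n<1+n; m+n∸n≡m)
  open import Data.Bool using (Bool; true; false; if_then_else_; _∧_; _∨_; not)
  open import Data.Bool.Properties using (∨-conicalˡ; ∨-conicalʳ)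
  open import Data.Fin as Fin using (Fin)
  open import Data.Vec using (Vec; _∷_; toList)
  open import Data.List using (List; []; _∷_; map; length; allFin)
  import Data.List.Properties as LP
  open import Data.Bool.ListAction using (all; any)
  open import Data.Product using (_×_; _,_)
  open import Data.Unit using (⊤; tt)
  open import Relation.Nullary.Decidable using (⌊_⌋; yes; no)
  open import Relation.Binary.PropositionalEquality
  open Counting

  _==_ : ∀ {a} → Fin a → Fin a → Bool
  x == y = ⌊ x Fin.≟ y ⌋

  ==⇒≡ : ∀ {a} (x y : Fin a) → x == y ≡ true → x ≡ y
  ==⇒≡ x y eq with x Fin.≟ y
  ... | yes x≡y = x≡y
  ==⇒≡ x y () | no _

  ==-suc : ∀ {a} (x y : Fin a) → Fin.suc x == Fin.suc y ≡ x == y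
  ==-suc x y with x Fin.≟ y
  ... | yes _ = refl
  ... | no _  = refl

  _∈ᵇ_ : ∀ {a} → Fin a → List (Fin a) → Bool
  x ∈ᵇ ys = any (x ==_) ys

  remove : ∀ {a} → Fin a → List (Fin a) → List (Fin a)
  remove x []       = []
  remove x (y ∷ ys) = if x == y then remove x ys else y ∷ remove x ys

  Distinct : ∀ {a} → List (Fin a) → Set
  Distinct []       = ⊤
  Distinct (y ∷ ys) = (y ∈ᵇ ys ≡ false) × Distinct ys

  remove-absent : ∀ {a} (x : Fin a) ys → x ∈ᵇ ys ≡ false → remove x ys ≡ ys
  remove-absent x []       _ = refl
  remove-absent x (y ∷ ys) x∉ rewrite ∨-conicalˡ (x == y) (x ∈ᵇ ys) x∉ =
    cong (y ∷_) (remove-absent x ys (∨-conicalʳ (x == y) (x ∈ᵇ ys) x∉))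

  ∉-remove : ∀ {a} (x z : Fin a) ys → z ∈ᵇ ys ≡ false → z ∈ᵇ remove x ys ≡ false
  ∉-remove x z []       _ = refl
  ∉-remove x z (y ∷ ys) z∉ with x == y
  ... | true  = ∉-remove x z ys (∨-conicalʳ (z == y) (z ∈ᵇ ys) z∉)
  ... | false rewrite ∨-conicalˡ (z == y) (z ∈ᵇ ys) z∉ =
    ∉-remove x z ys (∨-conicalʳ (z == y) (z ∈ᵇ ys) z∉)

  Distinct-remove : ∀ {a} (x : Fin a) ys → Distinct ys → Distinct (remove x ys)
  Distinct-remove x []       _                = tt
  Distinct-remove x (y ∷ ys) (y∉ys , distinct) with x == y
  ... | true  = Distinct-remove x ys distinct
  ... | false = ∉-remove x y ys y∉ys , Distinct-remove x ys distinct

  length-remove : ∀ {a} (x : Fin a) ys → Distinct ys → x ∈ᵇ ys ≡ true →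
                  suc (length (remove x ys)) ≡ length ys
  length-remove x (y ∷ ys) (y∉ys , distinct) x∈ with x == y in x=y
  ... | true rewrite ==⇒≡ x y x=y | remove-absent y ys y∉ys = refl
  ... | false = cong suc (length-remove x ys distinct x∈)

  allFin-suc : ∀ a → allFin (suc a) ≡ Fin.zero ∷ map Fin.suc (allFin a)
  allFin-suc a = cong (Fin.zero ∷_) (sym (LP.map-tabulate (λ i → i) Fin.suc))

  count-== : ∀ a (c : Fin a) → count (_== c) (allFin a) ≡ 1
  count-== (suc a) c = trans (cong (count (_== c)) (allFin-suc a)) (split c)
    where
    split : ∀ c → count (_== c) (Fin.zero ∷ map Fin.suc (allFin a)) ≡ 1
    split Fin.zero    = cong suc (trans (count-map (_== Fin.zero) Fin.suc (allFin a)) (count-false (allFin a)))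
    split (Fin.suc c) = trans (count-map (_== Fin.suc c) Fin.suc (allFin a))
                              (trans (count-cong (λ x → ==-suc x c) (allFin a)) (count-== a c))

  count-∈ᵇ : ∀ a (ys : List (Fin a)) → Distinct ys → count (_∈ᵇ ys) (allFin a) ≡ length ys
  count-∈ᵇ a []       _                = count-false (allFin a)
  count-∈ᵇ a (y ∷ ys) (y∉ys , distinct) =
    trans (count-∨ (_== y) (_∈ᵇ ys)
                   (λ x x=y → subst (λ z → z ∈ᵇ ys ≡ false) (sym (==⇒≡ x y x=y)) y∉ys) (allFin a))
          (cong₂ _+_ (count-== a y) (count-∈ᵇ a ys distinct))

  ∈ᵇ-suc : ∀ {a} (c : Fin a) ys → Fin.suc c ∈ᵇ map Fin.suc ys ≡ c ∈ᵇ ys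
  ∈ᵇ-suc c []       = refl
  ∈ᵇ-suc c (y ∷ ys) = cong₂ _∨_ (==-suc c y) (∈ᵇ-suc c ys)

  zero-∉ᵇ-suc : ∀ {a} (ys : List (Fin a)) → Fin.zero ∈ᵇ map Fin.suc ys ≡ false
  zero-∉ᵇ-suc []       = refl
  zero-∉ᵇ-suc (y ∷ ys) = zero-∉ᵇ-suc ys

  Distinct-map-suc : ∀ {a} (ys : List (Fin a)) → Distinct ys → Distinct (map Fin.suc ys)
  Distinct-map-suc []       _                = tt
  Distinct-map-suc (y ∷ ys) (y∉ys , distinct) = trans (∈ᵇ-suc y ys) y∉ys , Distinct-map-suc ys distinct

  Distinct-allFin : ∀ a → Distinct (allFin a)
  Distinct-allFin zero    = tt
  Distinct-allFin (suc a) = subst Distinct (sym (allFin-suc a))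
    (zero-∉ᵇ-suc (allFin a) , Distinct-map-suc (allFin a) (Distinct-allFin a))

  ordinaryColours : (r : ℕ) → List (Fin (suc r))
  ordinaryColours r = map Fin.suc (allFin r)

  Distinct-ordinary : ∀ r → Distinct (ordinaryColours r)
  Distinct-ordinary r = Distinct-map-suc (allFin r) (Distinct-allFin r)

  length-ordinary : ∀ r → length (ordinaryColours r) ≡ r
  length-ordinary r = trans (LP.length-map Fin.suc (allFin r)) (LP.length-tabulate (λ i → i))

  uncovered : (r : ℕ) → List (Fin (suc r)) → ℕ
  uncovered r req = count (λ x → not (x ∈ᵇ req)) (allFin (suc r))

  uncovered-length : ∀ r req → Distinct req → uncovered r req ≡ suc r ∸ length req
  uncovered-length r req distinct = begin
    uncovered r req
      ≡⟨ m+n∸n≡m (uncovered r req) (length req) ⟨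
    uncovered r req + length req ∸ length req
      ≡⟨ cong (λ c → uncovered r req + c ∸ length req) (count-∈ᵇ (suc r) req distinct) ⟨
    uncovered r req + count (_∈ᵇ req) (allFin (suc r)) ∸ length req
      ≡⟨ cong (_∸ length req) (count-not (_∈ᵇ req) (allFin (suc r))) ⟩
    length (allFin (suc r)) ∸ length req
      ≡⟨ cong (_∸ length req) (LP.length-tabulate (λ i → i)) ⟩
    suc r ∸ length req ∎
    where open ≡-Reasoning

  covers : ∀ {r n} → List (Fin (suc r)) → Vec (Fin (suc r)) n → Bool
  covers req v = all (λ c → occurs c (toList v)) req

  covers-cons : ∀ {r n} (req : List (Fin (suc r))) x (v : Vec (Fin (suc r)) n) →
                covers req (x ∷ v) ≡ covers (remove x req) v
  covers-cons []       x v = refl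
  covers-cons (c ∷ cs) x v with x == c
  ... | true  = covers-cons cs x v
  ... | false = cong (occurs c (toList v) ∧_) (covers-cons cs x v)

  ordinaryNonempty≡covers : ∀ {r n} (v : Vec (Fin (suc r)) n) →
                            ordinaryNonempty v ≡ covers (ordinaryColours r) v
  ordinaryNonempty≡covers {r} v = sym (all-map-suc (allFin r))
    where
    all-map-suc : ∀ cs → covers (map Fin.suc cs) v ≡ all (λ i → occurs (Fin.suc i) (toList v)) cs
    all-map-suc []       = refl
    all-map-suc (c ∷ cs) = cong (occurs (Fin.suc c) (toList v) ∧_) (all-map-suc cs)

  coverCount : (r : ℕ) → List (Fin (suc r)) → ℕ → ℕ
  coverCount r req n = count (covers req) (allVecs n (allFin (suc r)))

  coverCount-suc : ∀ r req n →
                   coverCount r req (suc n) ≡ sumN (allFin (suc r)) (λ x → coverCount r (remove x req) n)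
  coverCount-suc r req n =
    trans (count-concatMap (covers req) (λ x → map (x ∷_) words) (allFin (suc r)))
          (sumN-cong (λ x → trans (count-map (covers req) (x ∷_) words)
                                  (count-cong (covers-cons req x) words))
                     (allFin (suc r)))
    where words = allVecs n (allFin (suc r))

  coverCount-short : ∀ r n req → Distinct req → n < length req → coverCount r req n ≡ 0
  coverCount-short r zero    (c ∷ cs) _        _     = refl
  coverCount-short r (suc n) req      distinct short =
    trans (coverCount-suc r req n) (sumN-vanish (allFin (suc r)) afterFirst)
    where
    afterFirst : ∀ x → coverCount r (remove x req) n ≡ 0
    afterFirst x with x ∈ᵇ req in x∈
    ... | true  = coverCount-short r n (remove x req) (Distinct-remove x req distinct)
                    (≤-pred (subst (suc (suc n) ≤_) (sym (length-remove x req distinct x∈)) short))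
    ... | false rewrite remove-absent x req x∈ = coverCount-short r n req distinct (<-trans (n<1+n n) short)

-- For r fixed, the number of words of length n covering s distinct required
-- letters is killed by  (r+1 − E)(r − E) ⋯ (r+1−s − E).  Induction on s: by the
-- first-letter decomposition, E acts on it as multiplication by the number
-- r+1−s of non-required letters, modulo words covering s−1 letters.
module Annihilation where
  open import Data.Nat using (zero; suc; _∸_; _≤_; _≤′_; ≤′-refl; ≤′-step)
  import Data.Nat.Properties as ℕP
  open import Data.Integer using (_+_; _*_; _-_)
  import Data.Integer.Properties as ℤP
  open import Data.Integer.Tactic.RingSolver using (solve-∀)
  open import Data.Bool using (Bool; true; false; not)
  open import Data.Fin using (Fin)
  open import Data.List using (List; []; _∷_; _++_; [_]; length; allFin)
  open import Relation.Binary.PropositionalEquality hiding ([_])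
  open IntegerSums
  open DifferenceOperators
  open StirlingOperator using (fallingFrom; falling)
  open Counting
  open CoveringWords

  coverSeq : (r : ℕ) → List (Fin (suc r)) → Seq
  coverSeq r req n = + coverCount r req n

  sumL-indicator : {A : Set} (p : A → Bool) (h : A → ℤ) (a : ℤ) →
                   (∀ x → p x ≡ true → h x ≡ a) → (∀ x → p x ≡ false → h x ≡ + 0) →
                   ∀ xs → sumL xs h ≡ + count p xs * a
  sumL-indicator p h a onP offP []       = refl
  sumL-indicator p h a onP offP (x ∷ xs) with p x in px
  ... | true  = trans (cong₂ _+_ (onP x px) (sumL-indicator p h a onP offP xs)) (collect a (+ count p xs))
    where
    collect : ∀ a X → a + X * a ≡ (+ 1 + X) * a
    collect = solve-∀
  ... | false = trans (cong₂ _+_ (offP x px) (sumL-indicator p h a onP offP xs)) (ℤP.+-identityˡ _)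

  not-true : ∀ {b} → not b ≡ true → b ≡ false
  not-true {false} _ = refl

  not-false : ∀ {b} → not b ≡ false → b ≡ true
  not-false {true} _ = refl

  coverSeq-step : ∀ r L req → (∀ x → x ∈ᵇ req ≡ true → Annihilates L (coverSeq r (remove x req))) →
                  Annihilates (L ++ [ + uncovered r req ]) (coverSeq r req)
  coverSeq-step r L req killed n = begin
    diffs (L ++ [ c ]) (coverSeq r req) n ≡⟨ diffs-snoc L c (coverSeq r req) n ⟩
    c * v n - v (suc n)                   ≡⟨ cong (λ z → c * v n - z) shiftEigen ⟩
    c * v n - c * v n                     ≡⟨ ℤP.+-inverseʳ (c * v n) ⟩
    + 0                                   ∎
    where
    open ≡-Reasoning
    c = + uncovered r req
    v = diffs L (coverSeq r req)
    alphabet = allFin (suc r)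
    shiftEigen : v (suc n) ≡ c * v n
    shiftEigen = begin
      v (suc n)
        ≡⟨ diffs-shift L (coverSeq r req) n ⟨
      diffs L (λ m → + coverCount r req (suc m)) n
        ≡⟨ diffs-cong L (λ m → trans (cong +_ (coverCount-suc r req m))
                                      (pos-sumN alphabet (λ x → coverCount r (remove x req) m))) n ⟩
      diffs L (λ m → sumL alphabet (λ x → coverSeq r (remove x req) m)) n
        ≡⟨ diffs-sumL L alphabet (λ x → coverSeq r (remove x req)) n ⟩
      sumL alphabet (λ x → diffs L (coverSeq r (remove x req)) n)
        ≡⟨ sumL-indicator (λ x → not (x ∈ᵇ req)) _ (v n)
             (λ x x∉ → cong (λ q → diffs L (coverSeq r q) n) (remove-absent x req (not-true x∉)))
             (λ x x∈ → killed x (not-false x∈) n) alphabet ⟩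
      c * v n ∎

  fallingFrom-snoc : ∀ t s → fallingFrom t s ++ [ + (t ∸ s) ] ≡ fallingFrom t (suc s)
  fallingFrom-snoc t       zero    = refl
  fallingFrom-snoc zero    (suc s) = cong (+ 0 ∷_)
    (trans (cong (λ z → fallingFrom 0 s ++ [ + z ]) (sym (ℕP.0∸n≡0 s))) (fallingFrom-snoc 0 s))
  fallingFrom-snoc (suc t) (suc s) = cong (+ suc t ∷_) (fallingFrom-snoc t s)

  coverSeq-annihilated : ∀ r s req → Distinct req → length req ≡ s →
                         Annihilates (fallingFrom (suc r) (suc s)) (coverSeq r req)
  coverSeq-annihilated r s req distinct len =
    subst (λ L → Annihilates L (coverSeq r req)) factors
          (coverSeq-step r (fallingFrom (suc r) s) req (discharge s req distinct len))
    where
    uncovered≡ : uncovered r req ≡ suc r ∸ s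
    uncovered≡ = trans (uncovered-length r req distinct) (cong (suc r ∸_) len)
    factors : fallingFrom (suc r) s ++ [ + uncovered r req ] ≡ fallingFrom (suc r) (suc s)
    factors = trans (cong (λ u → fallingFrom (suc r) s ++ [ + u ]) uncovered≡) (fallingFrom-snoc (suc r) s)
    discharge : ∀ s req → Distinct req → length req ≡ s → ∀ x → x ∈ᵇ req ≡ true →
                Annihilates (fallingFrom (suc r) s) (coverSeq r (remove x req))
    discharge zero    []  _        _   x ()
    discharge (suc s) req distinct len x x∈ =
      coverSeq-annihilated r s (remove x req) (Distinct-remove x req distinct)
        (ℕP.suc-injective (trans (length-remove x req distinct x∈) len))

  ordinaryCover-annihilated : ∀ r → Annihilates (falling (suc r)) (coverSeq r (ordinaryColours r))
  ordinaryCover-annihilated r =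
    coverSeq-annihilated r r (ordinaryColours r) (Distinct-ordinary r) (length-ordinary r)

  falling-mono : ∀ {a m} f → a ≤ m → Annihilates (falling a) f → Annihilates (falling m) f
  falling-mono f a≤m = go (ℕP.≤⇒≤′ a≤m)
    where
    go : ∀ {a m} → a ≤′ m → Annihilates (falling a) f → Annihilates (falling m) f
    go ≤′-refl           killed = killed
    go (≤′-step {m} a≤m) killed = annihilates-cons (falling m) (+ suc m) f (go a≤m killed)

-- Splitting the barred Callan sequences of size (n+1) × (k+1) by their number r
-- of ordinary pairs: the red colouring and the pair (blue colouring, bar) are
-- chosen independently, and w depends only on the latter.
module CallanDecomposition where
  open import Data.Nat as ℕ using (zero; suc; _*_; _≡ᵇ_)
  open import Data.Bool using (Bool; true; false; if_then_else_; _∧_)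
  open import Data.Bool.Properties using () renaming (_≟_ to _≟B_)
  open import Data.Fin as Fin using (Fin)
  open import Data.Vec using (Vec; []; _∷_; replicate)
  open import Data.List using (List; []; _∷_; map; concatMap; allFin; upTo)
  open import Relation.Nullary.Decidable using (does)
  open import Relation.Binary.PropositionalEquality
  open Counting
  open CoveringWords

  redCount : ℕ → ℕ → ℕ
  redCount n r = coverCount r (ordinaryColours r) n

  -- w of a barred Callan sequence; it ignores the red colouring, recorded here as empty.
  wOf : (r : ℕ) {k : ℕ} → Vec (Fin (suc r)) k → Fin (suc r) → ℕ
  wOf r blue bar = wStat {0} (mkBC r [] blue bar)

  blueBarCount : ℕ → ℕ → ℕ → ℕ
  blueBarCount k r j = sumN (allVecs k (allFin (suc r)))
    (λ blue → count (λ bar → ordinaryNonempty blue ∧ (wOf r blue bar ≡ᵇ j)) (allFin (suc r)))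

  redCount-vanish : ∀ n r → n < r → redCount n r ≡ 0
  redCount-vanish n r n<r =
    coverCount-short r n (ordinaryColours r) (Distinct-ordinary r) (subst (n <_) (sym (length-ordinary r)) n<r)

  sumN-guarded : {A B : Set} (p : A → Bool) (q : A → B → Bool) (ys : List B) (xs : List A) →
                 count p xs ≡ 0 → sumN xs (λ x → count (λ y → p x ∧ q x y) ys) ≡ 0
  sumN-guarded p q ys []       _    = refl
  sumN-guarded p q ys (x ∷ xs) none with p x | none
  ... | false | none′ = cong₂ ℕ._+_ (count-false ys) (sumN-guarded p q ys xs none′)
  ... | true  | ()

  blueBarCount-vanish : ∀ k r j → k < r → blueBarCount k r j ≡ 0
  blueBarCount-vanish k r j k<r =
    sumN-guarded ordinaryNonempty (λ blue bar → wOf r blue bar ≡ᵇ j)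
                 (allFin (suc r)) (allVecs k (allFin (suc r)))
      (trans (count-cong ordinaryNonempty≡covers (allVecs k (allFin (suc r)))) (redCount-vanish k r k<r))

  allVecs-singleton : ∀ {A : Set} k (x : A) → allVecs k (x ∷ []) ≡ replicate k x ∷ []
  allVecs-singleton zero    x = refl
  allVecs-singleton (suc k) x rewrite allVecs-singleton k x = refl

  redCount-none : ∀ n → redCount n 0 ≡ 1
  redCount-none n rewrite allVecs-singleton n (Fin.zero {0}) = refl

  blueBarCount-none : ∀ k j → blueBarCount k 0 j ≡ (if j ≡ᵇ 0 then 1 else 0)
  blueBarCount-none k j rewrite allVecs-singleton k (Fin.zero {0}) with j
  ... | zero  = refl
  ... | suc _ = refl

  counted : ∀ {n k} → ℕ → BarredCallan n k → Bool
  counted j α = validBC α ∧ (wStat α ≡ᵇ j)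

  candidates : (n k r : ℕ) → List (BarredCallan n k)
  candidates n k r = concatMap (λ red → concatMap (λ blue → map (mkBC r red blue) (allFin (suc r)))
                                                  (allVecs k (allFin (suc r))))
                               (allVecs n (allFin (suc r)))

  count-candidates : ∀ n k j r →
    count (counted j) (candidates n k r) ≡ redCount n r * blueBarCount k r j
  count-candidates n k j r = begin
    count (counted j) (candidates n k r)
      ≡⟨ count-concatMap (counted j) withRed reds ⟩
    sumN reds (λ red → count (counted j) (withRed red))
      ≡⟨ sumN-cong perRed reds ⟩
    sumN reds (λ red → if ordinaryNonempty red then blueBarCount k r j else 0)
      ≡⟨ sumN-indicator ordinaryNonempty (blueBarCount k r j) reds ⟩
    count ordinaryNonempty reds * blueBarCount k r j
      ≡⟨ cong (ℕ._* blueBarCount k r j) (count-cong ordinaryNonempty≡covers reds) ⟩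
    redCount n r * blueBarCount k r j ∎
    where
    open ≡-Reasoning
    reds  = allVecs n (allFin (suc r))
    blues = allVecs k (allFin (suc r))
    bars  = allFin (suc r)
    withRed : Vec (Fin (suc r)) n → List (BarredCallan n k)
    withRed red = concatMap (λ blue → map (mkBC r red blue) bars) blues
    guard : ∀ a → sumN blues (λ blue → count (λ bar → (a ∧ ordinaryNonempty blue) ∧ (wOf r blue bar ≡ᵇ j)) bars)
                  ≡ (if a then blueBarCount k r j else 0)
    guard true  = refl
    guard false = sumN-vanish blues (λ _ → count-false bars)
    perRed : ∀ red → count (counted j) (withRed red) ≡ (if ordinaryNonempty red then blueBarCount k r j else 0)
    perRed red =
      trans (count-concatMap (counted j) (λ blue → map (mkBC r red blue) bars) blues)
            (trans (sumN-cong (λ blue → count-map (counted j) (mkBC r red blue) bars) blues)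
                   (guard (ordinaryNonempty red)))

  callan-decomposition : ∀ n k j →
    callanCoeff (suc n) (suc k) j ≡ sumN (upTo (suc (suc n))) (λ r → redCount (suc n) r * blueBarCount (suc k) r j)
  callan-decomposition n k j = begin
    callanCoeff (suc n) (suc k) j
      ≡⟨ length-filter (λ α → wStat α ℕ.≟ j) (allBC (suc n) (suc k)) ⟩
    count (λ α → wStat α ≡ᵇ j) (allBC (suc n) (suc k))
      ≡⟨ count-filter (λ α → validBC α ≟B true) (λ α → wStat α ≡ᵇ j) all ⟩
    count (λ α → does (validBC α ≟B true) ∧ (wStat α ≡ᵇ j)) all
      ≡⟨ count-cong (λ α → cong (_∧ (wStat α ≡ᵇ j)) (does-≟true (validBC α))) all ⟩
    count (counted j) all
      ≡⟨ count-concatMap (counted j) (candidates (suc n) (suc k)) (upTo (suc (suc n))) ⟩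
    sumN (upTo (suc (suc n))) (λ r → count (counted j) (candidates (suc n) (suc k) r))
      ≡⟨ sumN-cong (count-candidates (suc n) (suc k) j) (upTo (suc (suc n))) ⟩
    sumN (upTo (suc (suc n))) (λ r → redCount (suc n) r * blueBarCount (suc k) r j) ∎
    where
    open ≡-Reasoning
    all : List (BarredCallan (suc n) (suc k))
    all = concatMap (candidates (suc n) (suc k)) (upTo (suc (suc n)))
    does-≟true : ∀ b → does (b ≟B true) ≡ b
    does-≟true true  = refl
    does-≟true false = refl

module CallanSum where
  open import Data.Nat as ℕ using (zero; suc; _≡ᵇ_)
  open import Data.Integer using (_*_)
  import Data.Integer.Properties as ℤP
  open import Data.Bool using (if_then_else_)
  open import Data.List using (upTo)
  open import Relation.Binary.PropositionalEquality
  open IntegerSums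
  open DifferenceOperators
  open StirlingOperator using (falling)
  open Counting using (sumN; pos-sumN)
  open CoveringWords using (ordinaryColours)
  open Annihilation using (coverSeq; ordinaryCover-annihilated; falling-mono)
  open CallanDecomposition

  term : (k j r : ℕ) → ℕ → ℤ
  term k j r n = + blueBarCount k r j * + redCount n r

  term-red-vanish : ∀ k j n r → n < r → term k j r n ≡ + 0
  term-red-vanish k j n r n<r rewrite redCount-vanish n r n<r = ℤP.*-zeroʳ (+ blueBarCount k r j)

  term-blue-vanish : ∀ k j n r → k < r → term k j r n ≡ + 0
  term-blue-vanish k j n r k<r rewrite blueBarCount-vanish k r j k<r = refl

  term-none : ∀ k j n → S 1 (λ r → term k j r n) ≡ + (if j ≡ᵇ 0 then 1 else 0)
  term-none k j n rewrite blueBarCount-none k j | redCount-none n with j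
  ... | zero  = refl
  ... | suc _ = refl

  callan-sum : ∀ n k j → + callanCoeff n k j ≡ S (suc k) (λ r → term k j r n)
  callan-sum zero    k       j = trans (sym (term-none k j 0))
    (S-stable 1 (suc k) (λ r → term k j r 0) (term-red-vanish k j 0) (λ r → term-blue-vanish k j 0 r))
  callan-sum (suc n) zero    j = sym (term-none 0 j (suc n))
  callan-sum (suc n) (suc k) j = begin
    + callanCoeff (suc n) (suc k) j                  ≡⟨ cong +_ (callan-decomposition n k j) ⟩
    + sumN (upTo (suc (suc n))) product              ≡⟨ pos-sumN (upTo (suc (suc n))) product ⟩
    sumL (upTo (suc (suc n))) (λ r → + product r)    ≡⟨ sumL-upTo (suc (suc n)) (λ r → + product r) ⟩
    S (suc (suc n)) (λ r → + product r)              ≡⟨ S-cong (suc (suc n)) (λ r _ → asTerm r) ⟩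
    S (suc (suc n)) (λ r → term (suc k) j r (suc n))
      ≡⟨ S-stable (suc (suc n)) (suc (suc k)) (λ r → term (suc k) j r (suc n))
                  (term-red-vanish (suc k) j (suc n)) (λ r → term-blue-vanish (suc k) j (suc n) r) ⟩
    S (suc (suc k)) (λ r → term (suc k) j r (suc n)) ∎
    where
    open ≡-Reasoning
    product : ℕ → ℕ
    product r = redCount (suc n) r ℕ.* blueBarCount (suc k) r j
    asTerm : ∀ r → + product r ≡ term (suc k) j r (suc n)
    asTerm r = trans (ℤP.pos-* (redCount (suc n) r) (blueBarCount (suc k) r j))
                     (ℤP.*-comm (+ redCount (suc n) r) (+ blueBarCount (suc k) r j))

  term-annihilated : ∀ k j r m → r < m → Annihilates (falling m) (term k j r)
  term-annihilated k j r m r<m n = begin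
    diffs (falling m) (term k j r) n
      ≡⟨ diffs-scale (falling m) (+ b) (coverSeq r (ordinaryColours r)) n ⟩
    + b * diffs (falling m) (coverSeq r (ordinaryColours r)) n
      ≡⟨ cong (_*_ (+ b)) (falling-mono (coverSeq r (ordinaryColours r)) r<m (ordinaryCover-annihilated r) n) ⟩
    + b * + 0
      ≡⟨ ℤP.*-zeroʳ (+ b) ⟩
    + 0 ∎
    where
    open ≡-Reasoning
    b = blueBarCount k r j

mainTheorem11 : (n m k : ℕ) → k < m → (j : ℕ) → stirlingCallanSumCoeff n k m j ≡ + 0
mainTheorem11 n m k k<m j = begin
  stirlingCallanSumCoeff n k m j
    ≡⟨ sumTo≡stirlingOp m C n ⟩
  stirlingOp m C n
    ≡⟨ stirlingOp≡diffs m C n ⟩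
  diffs (falling m) C n
    ≡⟨ diffs-cong (falling m) (λ p → callan-sum p k j) n ⟩
  diffs (falling m) (λ p → S (suc k) (λ r → term k j r p)) n
    ≡⟨ diffs-S (falling m) (suc k) (term k j) n ⟩
  S (suc k) (λ r → diffs (falling m) (term k j r) n)
    ≡⟨ S-vanish (suc k) (λ r r≤k → term-annihilated k j r m (≤-trans r≤k k<m) n) ⟩
  + 0 ∎
  where
  open import Data.Nat using (suc)
  open import Data.Nat.Properties using (≤-trans)
  open import Relation.Binary.PropositionalEquality using (module ≡-Reasoning)
  open ≡-Reasoning
  open IntegerSums using (S; S-vanish)
  open DifferenceOperators using (Seq; diffs; diffs-cong; diffs-S)
  open StirlingOperator using (stirlingOp; falling; sumTo≡stirlingOp; stirlingOp≡diffs)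
  open CallanSum using (term; callan-sum; term-annihilated)
  C : Seq
  C p = + callanCoeff p k j
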